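{- Let $P_m,P_n$ be two paths and let $f$ be an IASI of the join $P_m+P_n$ whose restrictions to $P_m$ and to $P_n$ are weak IASIs. Then $f$ is a weak IASI of $P_m+P_n$ if and only if $P_m$ or $P_n$ is $1$-uniform under $f$.
   Context: All graphs are finite and simple. $\mathbb{N}_0$ denotes the non-negative integers; for $A,B\subseteq\mathbb{N}_0$, $A+B=\{a+b:a\in A,b\in B\}$. An integer additive set-indexer (IASI) of a graph $G$ is an injective map $f:V(G)\to 2^{\mathbb{N}_0}$ such that $g_f:E(G)\to 2^{\mathbb{N}_0}$, $g_f(uv)=f(u)+f(v)$, is injective. A subgraph $H$ is $1$-uniform under $f$ if $|g_f(e)|=1$ for every edge $e$ of $H$. $f$ is a weak IASI if $|g_f(uv)|=\max(|f(u)|,|f(v)|)$ for every edge $uv$. The join $G_1+G_2$ has vertex set $V_1\cup V_2$ and edge set $E_1\cup E_2\cup\{uv:u\in V_1,v\in V_2\}$. -}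

module Defs where

open import Data.Nat using (ℕ; _+_; _≤_)
open import Data.Nat.Properties using (_≟_)
open import Data.Fin using (Fin; toℕ)
open import Data.Sum using (_⊎_; inj₁; inj₂)
open import Data.Product using (_×_)
open import Data.Unit using (⊤)
open import Data.Empty using (⊥)
open import Data.List using (List; length; deduplicate; cartesianProductWith)
open import Data.List.Membership.Propositional using (_∈_)
open import Function using (_∘_; _⇔_)
open import Relation.Binary.PropositionalEquality using (_≡_)

-- Finite subsets of ℕ₀, represented by lists (order / repetitions irrelevant).
Label : Set
Label = List ℕ

_≐_ : Label → Label → Set
A ≐ B = ∀ x → (x ∈ A) ⇔ (x ∈ B)

card : Label → ℕ
card A = length (deduplicate _≟_ A)

_⊕_ : Label → Label → Label
A ⊕ B = cartesianProductWith _+_ A B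

record Graph : Set₁ where
  field
    V   : Set
    Adj : V → V → Set
open Graph public

PathAdj : ∀ {m} → Fin m → Fin m → Set
PathAdj i j = (toℕ i + 1 ≡ toℕ j) ⊎ (toℕ j + 1 ≡ toℕ i)

Path : ℕ → Graph
Path m = record { V = Fin m ; Adj = PathAdj }

JoinAdj : (G H : Graph) → V G ⊎ V H → V G ⊎ V H → Set
JoinAdj G H (inj₁ u) (inj₁ v) = Adj G u v
JoinAdj G H (inj₂ u) (inj₂ v) = Adj H u v
JoinAdj G H (inj₁ u) (inj₂ v) = ⊤
JoinAdj G H (inj₂ u) (inj₁ v) = ⊤

Join : Graph → Graph → Graph
Join G H = record { V = V G ⊎ V H ; Adj = JoinAdj G H }

gf : (G : Graph) → (V G → Label) → V G → V G → Label
gf G f u v = f u ⊕ f v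

IsIASI : (G : Graph) → (V G → Label) → Set
IsIASI G f =
  (∀ u v → f u ≐ f v → u ≡ v) ×
  (∀ u v u' v' → Adj G u v → Adj G u' v' → gf G f u v ≐ gf G f u' v' →
     (u ≡ u' × v ≡ v') ⊎ (u ≡ v' × v ≡ u'))

max : ℕ → ℕ → ℕ
max = Data.Nat._⊔_

IsWeakIASI : (G : Graph) → (V G → Label) → Set
IsWeakIASI G f = IsIASI G f ×
  (∀ u v → Adj G u v → card (gf G f u v) ≡ max (card (f u)) (card (f v)))

OneUniform : (G : Graph) → (V G → Label) → Set
OneUniform G f = ∀ u v → Adj G u v → card (gf G f u v) ≡ 1

-- For non-empty finite A, B ⊆ ℕ one has |A + B| = max(|A|, |B|) exactly when |A| = 1 or
-- |B| = 1: a singleton only translates the other set, while if |B| ≥ 2 with lo < hi in B, the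
-- sets A + lo and {max A + hi} are disjoint parts of A + B, so |A + B| > |A|, and symmetrically
-- |A + B| > |B| when |A| ≥ 2. In a weak IASI of a graph without isolated vertices all labels
-- are non-empty (an empty label would force its neighbour's label to be empty as well), so the
-- cross edges of the join are weak iff for all u ∈ P_m and v ∈ P_n one of f(u), f(v) is a
-- singleton, i.e. iff all labels on one side are singletons; on a path with at least two
-- vertices that is the same as the path being 1-uniform.
module Submission where

open import Defs
open import Data.Nat using (ℕ; zero; suc; _+_; _≤_; _<_; _⊔_; z≤n; s≤s)
open import Data.Nat.Properties
open import Data.Fin using (Fin; zero; suc; toℕ; inject₁)
open import Data.Fin.Properties using (injective⇒≤; toℕ-inject₁; all?; ¬∀⟶∃¬)
open import Data.Sum using (_⊎_; inj₁; inj₂; fromInj₂)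
import Data.Sum as Sum
open import Data.Product using (_×_; _,_; proj₂; ∃; ∃₂; ∃-syntax)
open import Data.Unit using (tt)
open import Data.List using (List; []; _∷_; length; lookup; map; deduplicate)
open import Data.List.Properties using (length-map)
import Data.List.Extrema.Nat as Extrema
open import Data.List.Membership.Propositional using (_∈_)
open import Data.List.Membership.Propositional.Properties
  using (∈-lookup; ∈-deduplicate⁺; ∈-deduplicate⁻; ∈-map⁺; ∈-map⁻;
         ∈-cartesianProductWith⁺; ∈-cartesianProductWith⁻)
open import Data.List.Membership.Setoid.Properties using (index-injective)
open import Data.List.Relation.Binary.Subset.Propositional using (_⊆_)
open import Data.List.Relation.Unary.Any using (here; there; index)
open import Data.List.Relation.Unary.All as All using (All; _∷_)
open import Data.List.Relation.Unary.AllPairs using (_∷_)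
open import Data.List.Relation.Unary.Unique.Propositional using (Unique)
open import Data.List.Relation.Unary.Unique.Propositional.Properties using (map⁺)
open import Data.List.Relation.Unary.Unique.DecPropositional.Properties _≟_ using (deduplicate-!)
open import Function using (_∘_; id; _⇔_; mk⇔; Equivalence; Injective)
open import Relation.Binary.Definitions using (tri<; tri≈; tri>)
open import Relation.Binary.PropositionalEquality
open import Relation.Nullary using (yes; no; contradiction)
open import Relation.Unary using (Pred; Decidable)

Unique⇒lookup-injective : ∀ {a} {A : Set a} {xs : List A} → Unique xs →
  ∀ {i j} → lookup xs i ≡ lookup xs j → i ≡ j
Unique⇒lookup-injective (_ ∷ _) {zero} {zero} _ = refl
Unique⇒lookup-injective (x∉xs ∷ _) {zero} {suc j} eq = contradiction eq (All.lookup x∉xs (∈-lookup j))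
Unique⇒lookup-injective (x∉xs ∷ _) {suc i} {zero} eq = contradiction (sym eq) (All.lookup x∉xs (∈-lookup i))
Unique⇒lookup-injective (_ ∷ xs!) {suc i} {suc j} eq = cong suc (Unique⇒lookup-injective xs! eq)

Unique⇒length≤ : ∀ {a} {A : Set a} {xs ys : List A} → Unique xs → xs ⊆ ys → length xs ≤ length ys
Unique⇒length≤ {A = A} {xs} {ys} xs! xs⊆ys = injective⇒≤ {f = position} position-injective
  where
  position : Fin (length xs) → Fin (length ys)
  position i = index (xs⊆ys (∈-lookup i))

  position-injective : Injective _≡_ _≡_ position
  position-injective eq = Unique⇒lookup-injective xs! (index-injective (setoid A) _ _ eq)

length≤card : ∀ {xs : List ℕ} (A : Label) → Unique xs → xs ⊆ A → length xs ≤ card A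
length≤card A xs! xs⊆A = Unique⇒length≤ xs! (∈-deduplicate⁺ _≟_ ∘ xs⊆A)

card≤length : ∀ (A : Label) {ys : List ℕ} → A ⊆ ys → card A ≤ length ys
card≤length A A⊆ys = Unique⇒length≤ (deduplicate-! A) (A⊆ys ∘ ∈-deduplicate⁻ _≟_ A)

card-mono : ∀ (A B : Label) → A ⊆ B → card A ≤ card B
card-mono A B A⊆B = card≤length A (∈-deduplicate⁺ _≟_ ∘ A⊆B)

card-cong : ∀ (A B : Label) → A ⊆ B → B ⊆ A → card A ≡ card B
card-cong A B A⊆B B⊆A = ≤-antisym (card-mono A B A⊆B) (card-mono B A B⊆A)

card≡0⇒≡[] : ∀ (A : Label) → card A ≡ 0 → A ≡ []
card≡0⇒≡[] [] _ = refl

1≤card⇒∃∈ : ∀ (A : Label) → 1 ≤ card A → ∃ (_∈ A)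
1≤card⇒∃∈ (a ∷ _) _ = a , here refl

card≡1⇒singleton : ∀ (A : Label) → card A ≡ 1 → ∃[ a ] (a ∈ A × ∀ {x} → x ∈ A → x ≡ a)
card≡1⇒singleton A |A|≡1 with deduplicate _≟_ A in dedup≡
... | a ∷ [] = a , ∈-deduplicate⁻ _≟_ A (subst (a ∈_) (sym dedup≡) (here refl)) , only-a
  where
  only-a : ∀ {x} → x ∈ A → x ≡ a
  only-a x∈A with subst (_ ∈_) dedup≡ (∈-deduplicate⁺ _≟_ x∈A)
  ... | here x≡a = x≡a

2≤card⇒∃≢ : ∀ (B : Label) → 2 ≤ card B → ∃₂ λ x y → x ∈ B × y ∈ B × x ≢ y
2≤card⇒∃≢ B 2≤|B| with deduplicate _≟_ B in dedup≡ | deduplicate-! B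
2≤card⇒∃≢ B (s≤s ()) | _ ∷ [] | _
2≤card⇒∃≢ B _ | x ∷ y ∷ rest | (x≢y ∷ _) ∷ _ =
  x , y , ∈B (here refl) , ∈B (there (here refl)) , x≢y
  where
  ∈B : ∀ {z} → z ∈ x ∷ y ∷ rest → z ∈ B
  ∈B = ∈-deduplicate⁻ _≟_ B ∘ subst (_ ∈_) (sym dedup≡)

2≤card⇒∃< : ∀ (B : Label) → 2 ≤ card B → ∃₂ λ lo hi → lo ∈ B × hi ∈ B × lo < hi
2≤card⇒∃< B 2≤|B| with x , y , x∈B , y∈B , x≢y ← 2≤card⇒∃≢ B 2≤|B| with <-cmp x y
... | tri< x<y _ _ = x , y , x∈B , y∈B , x<y
... | tri≈ _ x≡y _ = contradiction x≡y x≢y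
... | tri> _ _ y<x = y , x , y∈B , x∈B , y<x

∃∈⇒maximum : ∀ {a : ℕ} (A : Label) → a ∈ A → ∃[ M ] (M ∈ A × All (_≤ M) A)
∃∈⇒maximum {a} A a∈A =
  Extrema.max a A , Extrema.argmax-all id {P = _∈ A} a∈A (All.tabulate id) , Extrema.xs≤max a A

⊕-comm-⊆ : ∀ (A B : Label) → A ⊕ B ⊆ B ⊕ A
⊕-comm-⊆ A B z∈A⊕B with a , b , a∈A , b∈B , refl ← ∈-cartesianProductWith⁻ _+_ A B z∈A⊕B =
  subst (_∈ B ⊕ A) (+-comm b a) (∈-cartesianProductWith⁺ _+_ b∈B a∈A)

card-⊕-comm : ∀ (A B : Label) → card (A ⊕ B) ≡ card (B ⊕ A)
card-⊕-comm A B = card-cong (A ⊕ B) (B ⊕ A) (⊕-comm-⊆ A B) (⊕-comm-⊆ B A)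

card-⊕-singleton : ∀ (A B : Label) → card A ≡ 1 → card (A ⊕ B) ≡ card B
card-⊕-singleton A B |A|≡1 with a , a∈A , only-a ← card≡1⇒singleton A |A|≡1 =
  ≤-antisym
    (subst (card (A ⊕ B) ≤_) |a+B|≡|B| (card≤length (A ⊕ B) A⊕B⊆a+B))
    (subst (_≤ card (A ⊕ B)) |a+B|≡|B|
       (length≤card (A ⊕ B) (map⁺ (+-cancelˡ-≡ a _ _) (deduplicate-! B)) a+B⊆A⊕B))
  where
  a+B : List ℕ
  a+B = map (a +_) (deduplicate _≟_ B)

  |a+B|≡|B| : length a+B ≡ card B
  |a+B|≡|B| = length-map (a +_) (deduplicate _≟_ B)

  A⊕B⊆a+B : A ⊕ B ⊆ a+B
  A⊕B⊆a+B z∈A⊕B with a′ , b , a′∈A , b∈B , refl ← ∈-cartesianProductWith⁻ _+_ A B z∈A⊕B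
    rewrite only-a a′∈A = ∈-map⁺ (a +_) (∈-deduplicate⁺ _≟_ b∈B)

  a+B⊆A⊕B : a+B ⊆ A ⊕ B
  a+B⊆A⊕B z∈a+B with b , b∈B , refl ← ∈-map⁻ (a +_) z∈a+B =
    ∈-cartesianProductWith⁺ _+_ a∈A (∈-deduplicate⁻ _≟_ B b∈B)

card<card-⊕ : ∀ (A B : Label) → 1 ≤ card A → 2 ≤ card B → card A < card (A ⊕ B)
card<card-⊕ A B 1≤|A| 2≤|B|
  with a , a∈A ← 1≤card⇒∃∈ A 1≤|A|
  with M , M∈A , A≤M ← ∃∈⇒maximum A a∈A
  with lo , hi , lo∈B , hi∈B , lo<hi ← 2≤card⇒∃< B 2≤|B| =
  subst (_≤ card (A ⊕ B)) (cong suc (length-map (_+ lo) (deduplicate _≟_ A)))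
    (length≤card (A ⊕ B) (All.tabulate M+hi∉A+lo ∷ map⁺ (+-cancelʳ-≡ lo _ _) (deduplicate-! A))
       M+hi∷A+lo⊆A⊕B)
  where
  A+lo : List ℕ
  A+lo = map (_+ lo) (deduplicate _≟_ A)

  M+hi∉A+lo : ∀ {z} → z ∈ A+lo → M + hi ≢ z
  M+hi∉A+lo z∈A+lo M+hi≡z with a′ , a′∈A , refl ← ∈-map⁻ (_+ lo) z∈A+lo =
    <-irrefl (sym M+hi≡z)
      (+-mono-≤-< (All.lookup A≤M (∈-deduplicate⁻ _≟_ A a′∈A)) lo<hi)

  M+hi∷A+lo⊆A⊕B : M + hi ∷ A+lo ⊆ A ⊕ B
  M+hi∷A+lo⊆A⊕B (here refl) = ∈-cartesianProductWith⁺ _+_ M∈A hi∈B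
  M+hi∷A+lo⊆A⊕B (there z∈A+lo) with a′ , a′∈A , refl ← ∈-map⁻ (_+ lo) z∈A+lo =
    ∈-cartesianProductWith⁺ _+_ (∈-deduplicate⁻ _≟_ A a′∈A) lo∈B

card-⊕≡⊔⇔singleton : ∀ (A B : Label) → 1 ≤ card A → 1 ≤ card B →
  card (A ⊕ B) ≡ max (card A) (card B) ⇔ (card A ≡ 1 ⊎ card B ≡ 1)
card-⊕≡⊔⇔singleton A B 1≤|A| 1≤|B| = mk⇔ to from
  where
  to : card (A ⊕ B) ≡ max (card A) (card B) → card A ≡ 1 ⊎ card B ≡ 1
  to |A⊕B|≡⊔ with card A ≟ 1 | card B ≟ 1
  ... | yes |A|≡1 | _ = inj₁ |A|≡1
  ... | no _ | yes |B|≡1 = inj₂ |B|≡1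
  ... | no |A|≢1 | no |B|≢1 = contradiction |A⊕B|≡⊔ (<⇒≢ (⊔-lub |A|<|A⊕B| |B|<|A⊕B|) ∘ sym)
    where
    |A|<|A⊕B| : card A < card (A ⊕ B)
    |A|<|A⊕B| = card<card-⊕ A B 1≤|A| (≤∧≢⇒< 1≤|B| (|B|≢1 ∘ sym))

    |B|<|A⊕B| : card B < card (A ⊕ B)
    |B|<|A⊕B| = subst (card B <_) (card-⊕-comm B A)
                  (card<card-⊕ B A 1≤|B| (≤∧≢⇒< 1≤|A| (|A|≢1 ∘ sym)))

  from : card A ≡ 1 ⊎ card B ≡ 1 → card (A ⊕ B) ≡ max (card A) (card B)
  from (inj₁ |A|≡1) = begin
    card (A ⊕ B)       ≡⟨ card-⊕-singleton A B |A|≡1 ⟩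
    card B             ≡⟨ m≤n⇒m⊔n≡n 1≤|B| ⟨
    1 ⊔ card B         ≡⟨ cong (_⊔ card B) |A|≡1 ⟨
    card A ⊔ card B    ∎
    where open ≡-Reasoning
  from (inj₂ |B|≡1) = begin
    card (A ⊕ B)       ≡⟨ card-⊕-comm A B ⟩
    card (B ⊕ A)       ≡⟨ card-⊕-singleton B A |B|≡1 ⟩
    card A             ≡⟨ m≥n⇒m⊔n≡m 1≤|A| ⟨
    card A ⊔ 1         ≡⟨ cong (card A ⊔_) |B|≡1 ⟨
    card A ⊔ card B    ∎
    where open ≡-Reasoning

NoIsolatedVertices : Graph → Set
NoIsolatedVertices G = ∀ u → ∃[ v ] (Adj G u v × u ≢ v)

PathAdj⇒≢ : ∀ {m} {i j : Fin m} → PathAdj i j → i ≢ j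
PathAdj⇒≢ {i = i} (inj₁ i+1≡j) refl = m+1+n≢m (toℕ i) i+1≡j
PathAdj⇒≢ {j = j} (inj₂ j+1≡i) refl = m+1+n≢m (toℕ j) j+1≡i

Path-neighbour : ∀ {k} (i : Fin (2 + k)) → ∃[ j ] PathAdj i j
Path-neighbour zero = suc zero , inj₁ refl
Path-neighbour (suc i) = inject₁ i , inj₂ (trans (+-comm (toℕ (inject₁ i)) 1) (cong suc (toℕ-inject₁ i)))

Path-noIsolatedVertices : ∀ {m} → 2 ≤ m → NoIsolatedVertices (Path m)
Path-noIsolatedVertices (s≤s (s≤s _)) i with j , i~j ← Path-neighbour i = j , i~j , PathAdj⇒≢ i~j

IsWeakIASI⇒1≤card : ∀ (G : Graph) (f : V G → Label) → NoIsolatedVertices G → IsWeakIASI G f →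
  ∀ u → 1 ≤ card (f u)
IsWeakIASI⇒1≤card G f noIsolated ((f-injective , _) , weak) u with f u in fu≡[]
... | _ ∷ _ = s≤s z≤n
... | [] with v , uv , u≢v ← noIsolated u =
  contradiction (f-injective u v (subst₂ _≐_ (sym fu≡[]) (sym fv≡[]) λ _ → mk⇔ id id)) u≢v
  where
  open ≡-Reasoning
  fv≡[] : f v ≡ []
  fv≡[] = card≡0⇒≡[] (f v) (begin
    card (f v)                      ≡⟨ cong (λ A → max (card A) (card (f v))) fu≡[] ⟨
    max (card (f u)) (card (f v))   ≡⟨ weak u v uv ⟨
    card (f u ⊕ f v)                ≡⟨ cong (λ A → card (A ⊕ f v)) fu≡[] ⟩
    0                               ∎)

singletons⇒OneUniform : ∀ (G : Graph) (f : V G → Label) → IsWeakIASI G f →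
  (∀ u → card (f u) ≡ 1) → OneUniform G f
singletons⇒OneUniform G f (_ , weak) |f|≡1 u v uv = trans (weak u v uv) (cong₂ max (|f|≡1 u) (|f|≡1 v))

OneUniform⇒singletons : ∀ (G : Graph) (f : V G → Label) → NoIsolatedVertices G → IsWeakIASI G f →
  OneUniform G f → ∀ u → card (f u) ≡ 1
OneUniform⇒singletons G f noIsolated w oneUniform u with v , uv , _ ← noIsolated u =
  ≤-antisym (≤-trans (m≤m⊔n _ _) (≤-reflexive (trans (sym (proj₂ w u v uv)) (oneUniform u v uv))))
            (IsWeakIASI⇒1≤card G f noIsolated w u)

Join-IsWeakIASI : ∀ (G H : Graph) (f : V (Join G H) → Label) →
  IsIASI (Join G H) f → IsWeakIASI G (f ∘ inj₁) → IsWeakIASI H (f ∘ inj₂) →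
  (∀ u v → card (f (inj₁ u) ⊕ f (inj₂ v)) ≡ max (card (f (inj₁ u))) (card (f (inj₂ v)))) →
  IsWeakIASI (Join G H) f
Join-IsWeakIASI G H f iasi (_ , weakG) (_ , weakH) weakCross = iasi , weak
  where
  weak : ∀ u v → Adj (Join G H) u v → card (f u ⊕ f v) ≡ max (card (f u)) (card (f v))
  weak (inj₁ u) (inj₁ v) uv = weakG u v uv
  weak (inj₂ u) (inj₂ v) uv = weakH u v uv
  weak (inj₁ u) (inj₂ v) _ = weakCross u v
  weak (inj₂ u) (inj₁ v) _ = begin
    card (f (inj₂ u) ⊕ f (inj₁ v))                ≡⟨ card-⊕-comm (f (inj₂ u)) (f (inj₁ v)) ⟩
    card (f (inj₁ v) ⊕ f (inj₂ u))                ≡⟨ weakCross v u ⟩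
    max (card (f (inj₁ v))) (card (f (inj₂ u)))   ≡⟨ ⊔-comm (card (f (inj₁ v))) _ ⟩
    max (card (f (inj₂ u))) (card (f (inj₁ v)))   ∎
    where open ≡-Reasoning

∀∀⊎⇒∀⊎∀ : ∀ {m b p q} {B : Set b} {P : Pred (Fin m) p} {Q : Pred B q} → Decidable P →
  (∀ i b → P i ⊎ Q b) → (∀ i → P i) ⊎ (∀ b → Q b)
∀∀⊎⇒∀⊎∀ {m} {P = P} P? P⊎Q with all? P?
... | yes ∀P = inj₁ ∀P
... | no ¬∀P with i , ¬Pi ← ¬∀⟶∃¬ m P P? ¬∀P = inj₂ λ b → fromInj₂ (λ Pi → contradiction Pi ¬Pi) (P⊎Q i b)

mainTheorem4 : (m n : ℕ) → 2 ≤ m → 2 ≤ n →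
    (f : V (Join (Path m) (Path n)) → Label) →
    IsIASI (Join (Path m) (Path n)) f →
    IsWeakIASI (Path m) (f ∘ inj₁) →
    IsWeakIASI (Path n) (f ∘ inj₂) →
    IsWeakIASI (Join (Path m) (Path n)) f
      ⇔ (OneUniform (Path m) (f ∘ inj₁) ⊎ OneUniform (Path n) (f ∘ inj₂))
mainTheorem4 m n 2≤m 2≤n f iasi weakPm weakPn = mk⇔ to from
  where
  noIsolatedPm = Path-noIsolatedVertices 2≤m
  noIsolatedPn = Path-noIsolatedVertices 2≤n

  cross : ∀ u v → card (f (inj₁ u) ⊕ f (inj₂ v)) ≡ max (card (f (inj₁ u))) (card (f (inj₂ v)))
                  ⇔ (card (f (inj₁ u)) ≡ 1 ⊎ card (f (inj₂ v)) ≡ 1)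
  cross u v = card-⊕≡⊔⇔singleton (f (inj₁ u)) (f (inj₂ v))
    (IsWeakIASI⇒1≤card (Path m) (f ∘ inj₁) noIsolatedPm weakPm u)
    (IsWeakIASI⇒1≤card (Path n) (f ∘ inj₂) noIsolatedPn weakPn v)

  to : IsWeakIASI (Join (Path m) (Path n)) f → OneUniform (Path m) (f ∘ inj₁) ⊎ OneUniform (Path n) (f ∘ inj₂)
  to (_ , weak) = Sum.map (singletons⇒OneUniform (Path m) (f ∘ inj₁) weakPm)
                          (singletons⇒OneUniform (Path n) (f ∘ inj₂) weakPn)
    (∀∀⊎⇒∀⊎∀ (λ u → card (f (inj₁ u)) ≟ 1) λ u v → Equivalence.to (cross u v) (weak (inj₁ u) (inj₂ v) tt))

  from : OneUniform (Path m) (f ∘ inj₁) ⊎ OneUniform (Path n) (f ∘ inj₂) → IsWeakIASI (Join (Path m) (Path n)) f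
  from oneUniform = Join-IsWeakIASI (Path m) (Path n) f iasi weakPm weakPn λ u v →
    Equivalence.from (cross u v)
      (Sum.map (λ ou → OneUniform⇒singletons (Path m) (f ∘ inj₁) noIsolatedPm weakPm ou u)
               (λ ou → OneUniform⇒singletons (Path n) (f ∘ inj₂) noIsolatedPn weakPn ou v) oneUniform)
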